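{- Let $G$ be a graph of girth at least five whose maximum average degree $d$ satisfies $d\ge 2$. Then every fractional $2$-guidance system and every weak $2$-guidance system of $G$ has maximum outdegree at least $d/2$.
   Context: All graphs are finite, simple and undirected. The maximum average degree of $G$ is the maximum of the average degrees of its subgraphs. For $u,v$ at distance $\ell$, $N_G(u\to v)$ is the set of neighbors of $u$ at distance $\ell-1$ from $v$. A fractional orientation of $G$ assigns a non-negative real $p(u,v)$ to each ordered pair with $uv\in E(G)$; its maximum outdegree is $\max_u\sum_{v:uv\in E(G)}p(u,v)$; it is a fractional $r$-guidance system if for all $u,v$ at distance $\ell$ with $2\le \ell\le r$, $\sum_{w\in N_G(u\to v)}p(u,w)+\sum_{w\in N_G(v\to u)}p(v,w)\ge1$. A partial orientation of $G$ is a directed graph $\vec{H}$ on $V(G)$ whose arcs $(u,v)$ satisfy $uv\in E(G)$; $B_{\vec{H}}(v,a)$ is the set of vertices reachable from $v$ by directed paths of length at most $a$. A weak $r$-guidance system is a partial orientation $\vec{H}$ such that for any distinct $u,v$ at distance $\ell\le r$ there are non-negative integers $a,b$ with $a+b=\ell-1$ and an edge of $G$ between $B_{\vec{H}}(u,a)$ and $B_{\vec{H}}(v,b)$.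
   Formalization: The values $p(u,v)$ of the fractional orientations are only non-negative rationals rather than non-negative reals. -}

module Defs where

open import Data.Nat as ℕ using (ℕ; zero; suc; _∸_)
open import Data.Fin using (Fin; zero; suc; inject₁; fromℕ; _≟_)
open import Data.Bool using (Bool; true; false; _∧_; _∨_; not; if_then_else_)
open import Data.Rational using (ℚ; 0ℚ; 1ℚ; _+_; _*_; _≤_; _/_)
open import Data.Integer using (+_)
open import Data.Product using (Σ; ∃; ∃-syntax; _×_; _,_)
open import Data.Vec using (Vec; lookup)
open import Data.Fin.Subset using (Subset; _∈_; ∣_∣)
open import Function.Definitions using (Injective)
open import Relation.Binary.PropositionalEquality using (_≡_; _≢_)
open import Relation.Nullary using (¬_; does)

record Graph (n : ℕ) : Set where
  field
    Adj    : Fin n → Fin n → Bool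
    sym    : ∀ u v → Adj u v ≡ Adj v u
    irrefl : ∀ u → Adj u u ≡ false
open Graph public

Edge : ∀ {n} → Graph n → Fin n → Fin n → Set
Edge G u v = Adj G u v ≡ true

anyFin : ∀ {n} → (Fin n → Bool) → Bool
anyFin {zero}  f = false
anyFin {suc n} f = f zero ∨ anyFin (λ i → f (suc i))

sumℚ : ∀ {n} → (Fin n → ℚ) → ℚ
sumℚ {zero}  f = 0ℚ
sumℚ {suc n} f = f zero + sumℚ (λ i → f (suc i))

sumℕ : ∀ {n} → (Fin n → ℕ) → ℕ
sumℕ {zero}  f = 0
sumℕ {suc n} f = f zero ℕ.+ sumℕ (λ i → f (suc i))

ℕ→ℚ : ℕ → ℚ
ℕ→ℚ k = (+ k) / 1

[_]ℕ : Bool → ℕ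
[ true ]ℕ  = 1
[ false ]ℕ = 0

-- Girth: a cycle of length suc m (m ≥ 2) is an injective closed walk
-- c 0, c 1, ..., c m, c 0.  girth ≥ g  iff  no cycle of length < g.

Cycle : ∀ {n} → Graph n → ℕ → Set
Cycle {n} G zero    = Data.Empty.⊥ where import Data.Empty
Cycle {n} G (suc m) =
  Σ (Fin (suc m) → Fin n) λ c →
    Injective _≡_ _≡_ c ×
    (∀ (i : Fin m) → Edge G (c (inject₁ i)) (c (suc i))) ×
    Edge G (c (fromℕ m)) (c zero)

GirthAtLeast : ∀ {n} → Graph n → ℕ → Set
GirthAtLeast G g = ∀ k → 3 ℕ.≤ k → k ℕ.< g → ¬ Cycle G k

ball : ∀ {n} → Graph n → ℕ → Fin n → Fin n → Bool
ball G zero    u v = does (u ≟ v)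
ball G (suc k) u v = ball G k u v ∨ anyFin (λ w → Adj G u w ∧ ball G k w v)

distIs : ∀ {n} → Graph n → Fin n → Fin n → ℕ → Bool
distIs G u v zero    = ball G zero u v
distIs G u v (suc ℓ) = ball G (suc ℓ) u v ∧ not (ball G ℓ u v)

Dist : ∀ {n} → Graph n → Fin n → Fin n → ℕ → Set
Dist G u v ℓ = distIs G u v ℓ ≡ true

inNto : ∀ {n} → Graph n → ℕ → Fin n → Fin n → Fin n → Bool
inNto G ℓ u v w = Adj G u w ∧ distIs G w v (ℓ ∸ 1)

-- Maximum average degree.
-- A subgraph H: vertex set S, edge set F ⊆ E(G) with both ends in S.
-- 2|E(H)| = Σ_u Σ_v [uv ∈ F]; average degree = 2|E(H)| / |V(H)|.

record Subgraph {n} (G : Graph n) : Set where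
  field
    S      : Subset n
    F      : Fin n → Fin n → Bool
    F-sym  : ∀ u v → F u v ≡ F v u
    F-edge : ∀ u v → F u v ≡ true → Edge G u v
    F-inS  : ∀ u v → F u v ≡ true → (u ∈ S) × (v ∈ S)
open Subgraph public

twiceEdges : ∀ {n} {G : Graph n} → Subgraph G → ℕ
twiceEdges H = sumℕ (λ u → sumℕ (λ v → [ F H u v ]ℕ))

-- "average degree of H is at most d" / "equals d" (H nonempty),
-- written without division: 2|E(H)| ≤ d·|V(H)|.
AvgDeg≤ : ∀ {n} {G : Graph n} → Subgraph G → ℚ → Set
AvgDeg≤ H d = ℕ→ℚ (twiceEdges H) ≤ d * ℕ→ℚ ∣ S H ∣

AvgDeg≡ : ∀ {n} {G : Graph n} → Subgraph G → ℚ → Set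
AvgDeg≡ H d = ℕ→ℚ (twiceEdges H) ≡ d * ℕ→ℚ ∣ S H ∣

IsMad : ∀ {n} → Graph n → ℚ → Set
IsMad G d =
  (∀ (H : Subgraph G) → 1 ℕ.≤ ∣ S H ∣ → AvgDeg≤ H d) ×
  (Σ (Subgraph G) λ H → 1 ℕ.≤ ∣ S H ∣ × AvgDeg≡ H d)

FractionalOrientation : ∀ {n} → Graph n → (Fin n → Fin n → ℚ) → Set
FractionalOrientation G p = ∀ u v → Edge G u v → 0ℚ ≤ p u v

fracOutdeg : ∀ {n} → Graph n → (Fin n → Fin n → ℚ) → Fin n → ℚ
fracOutdeg G p u = sumℚ (λ v → if Adj G u v then p u v else 0ℚ)

FracMaxOutdeg≥ : ∀ {n} → Graph n → (Fin n → Fin n → ℚ) → ℚ → Set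
FracMaxOutdeg≥ G p x = ∃[ u ] (x ≤ fracOutdeg G p u)

FractionalGuidance : ∀ {n} → Graph n → ℕ → (Fin n → Fin n → ℚ) → Set
FractionalGuidance G r p =
  ∀ u v ℓ → 2 ℕ.≤ ℓ → ℓ ℕ.≤ r → Dist G u v ℓ →
    1ℚ ≤ sumℚ (λ w → if inNto G ℓ u v w then p u w else 0ℚ)
       + sumℚ (λ w → if inNto G ℓ v u w then p v w else 0ℚ)

PartialOrientation : ∀ {n} → Graph n → (Fin n → Fin n → Bool) → Set
PartialOrientation G A = ∀ u v → A u v ≡ true → Edge G u v

ballA : ∀ {n} → (Fin n → Fin n → Bool) → ℕ → Fin n → Fin n → Bool
ballA A zero    v x = does (v ≟ x)
ballA A (suc a) v x = ballA A a v x ∨ anyFin (λ w → A v w ∧ ballA A a w x)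

outdegA : ∀ {n} → (Fin n → Fin n → Bool) → Fin n → ℕ
outdegA A u = sumℕ (λ v → [ A u v ]ℕ)

MaxOutdeg≥ : ∀ {n} → (Fin n → Fin n → Bool) → ℚ → Set
MaxOutdeg≥ A x = ∃[ u ] (x ≤ ℕ→ℚ (outdegA A u))

WeakGuidance : ∀ {n} → Graph n → ℕ → (Fin n → Fin n → Bool) → Set
WeakGuidance G r A =
  ∀ u v ℓ → u ≢ v → ℓ ℕ.≤ r → Dist G u v ℓ →
    ∃[ a ] ∃[ b ] (a ℕ.+ b ≡ ℓ ∸ 1 ×
      ∃[ x ] ∃[ y ] (ballA A a u x ≡ true × ballA A b v y ≡ true × Edge G x y))

{-# OPTIONS --safe #-}
module Submission where

-- In a graph of girth at least five, two distinct neighbours u, v of a vertex w are at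
-- distance two and w is their only common neighbour.  Hence a fractional 2-guidance system p
-- satisfies p(u,w) + p(v,w) ≥ 1, and so does the 0/1 weighting by the arcs of a weak
-- 2-guidance system.
--
-- Let H be a subgraph of average degree d = mad(G).  Deleting a vertex of degree one removes
-- one edge, so as d ≥ 2 the average degree stays at least d, hence equals d by maximality; we
-- may therefore assume that H has no vertex of degree one.  At a vertex w of degree k ≠ 1 in H
-- the pairwise condition forces Σ_u p(u,w) ≥ k/2 over the neighbours u of w in H.  Summing
-- over w, the vertices of H have total outdegree at least |E(H)| = d |V(H)| / 2, so one of
-- them has outdegree at least d/2.

open import Defs
open import Data.Nat using (ℕ)
open import Data.Fin using (Fin)
open import Data.Bool using (Bool)
open import Data.Rational using (ℚ; _≤_; _*_; ½; _/_)
open import Data.Integer using (+_)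
open import Data.Product using (_×_)

open import Algebra.Bundles using (CommutativeMonoid; Ring)
import Algebra.Properties.CommutativeMonoid.Sum as CommutativeMonoidSum
import Algebra.Properties.Semiring.Sum as SemiringSum
open import Data.Bool using (true; false; _∧_; _∨_; not; if_then_else_)
import Data.Bool as Bool
open import Data.Bool.Properties using (∧-conicalˡ; ∧-conicalʳ; ∧-comm; ∨-zeroʳ; ¬-not)
open import Data.Fin using (zero; suc; _≟_; punchIn; inject₁; fromℕ)
open import Data.Fin.Properties using (punchInᵢ≢i; any?)
open import Data.Fin.Subset using (Subset; _∈_; ∣_∣) renaming (_-_ to _∖_)
open import Data.Fin.Subset.Properties using (x∈p∧x≢y⇒x∈p-y; x∈p⇒∣p-x∣<∣p∣)
import Data.Integer as ℤ
import Data.Integer.Properties as ℤ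
open import Data.Nat using (zero; suc)
import Data.Nat as ℕ
import Data.Nat.Coprimality as Coprime
open import Data.Nat.Induction using (<-wellFounded)
import Data.Nat.Properties as ℕ
open import Data.Product using (Σ; ∃-syntax; _,_; proj₁; proj₂; uncurry)
open import Data.Rational using (0ℚ; 1ℚ; _+_; _-_; -_; _<_; mkℚ; *≤*; nonNegative)
import Data.Rational.Properties as ℚ
open import Data.Rational.Solver using (module +-*-Solver)
open import Data.Sum using (_⊎_; inj₁; inj₂; [_,_]′; fromInj₂)
open import Data.Vec using (Vec; []; _∷_; lookup)
import Data.Vec.Properties as Vec
open import Data.Vec.Functional using (Vector)
open import Data.Vec.Relation.Unary.All using ([]; _∷_)
open import Data.Vec.Relation.Unary.AllPairs using ([]; _∷_)
open import Data.Vec.Relation.Unary.Unique.Propositional using (Unique)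
open import Data.Vec.Relation.Unary.Unique.Propositional.Properties using (lookup-injective)
open import Function using (_∘_)
open import Induction.WellFounded using (Acc; acc)
open import Relation.Binary.Bundles using (Setoid)
import Relation.Binary.PropositionalEquality as ≡
open ≡ using (_≡_; _≢_; refl; cong; cong₂; subst; subst₂; ≢-sym)
open import Relation.Nullary using (¬_; does; yes; no; contradiction)
open import Relation.Nullary.Decidable using (dec-true; dec-false; decidable-stable; _×-dec_)

open +-*-Solver using (solve; _:+_; _:-_; _:*_; _:=_; con)

-- Finite sums

module _ {c ℓ} (M : CommutativeMonoid c ℓ) where
  open CommutativeMonoid M using (Carrier; _≈_; setoid; reflexive; ∙-cong; identityʳ)
    renaming (_∙_ to _⊕_; ε to 0#)
  open CommutativeMonoidSum M using (sum; sum-remove; sum-cong-≋; sum-replicate-zero)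
  open import Relation.Binary.Reasoning.Setoid setoid
  private module M = Setoid setoid

  sum-select : ∀ {n} (f : Vector Carrier n) (j : Fin n) →
               sum (λ i → if does (i ≟ j) then f i else 0#) ≈ f j
  sum-select {suc n} f j = begin
    sum g
      ≈⟨ sum-remove {i = j} g ⟩
    g j ⊕ sum (λ i → g (punchIn j i))
      ≈⟨ ∙-cong (reflexive g-at-j) (M.trans (sum-cong-≋ off-j) (sum-replicate-zero n)) ⟩
    f j ⊕ 0#
      ≈⟨ identityʳ (f j) ⟩
    f j ∎
    where
    g : Vector Carrier (suc n)
    g i = if does (i ≟ j) then f i else 0#
    g-at-j : g j ≡ f j
    g-at-j rewrite dec-true (j ≟ j) refl = refl
    off-j : ∀ i → g (punchIn j i) ≈ 0#
    off-j i rewrite dec-false (punchIn j i ≟ j) (punchInᵢ≢i j i) = M.refl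

open SemiringSum (Ring.semiring ℚ.+-*-ring)
  using (sum; sum-cong-≗; sum-replicate-zero; ∑-comm; ∑-distrib-+; *-distribʳ-sum)
module ∑ℕ = SemiringSum ℕ.+-*-semiring

sumℚ≡sum : ∀ {n} (f : Fin n → ℚ) → sumℚ f ≡ sum f
sumℚ≡sum {zero}  f = refl
sumℚ≡sum {suc n} f = cong (λ s → f zero + s) (sumℚ≡sum (f ∘ suc))

sumℕ≡sum : ∀ {n} (f : Fin n → ℕ) → sumℕ f ≡ ∑ℕ.sum f
sumℕ≡sum {zero}  f = refl
sumℕ≡sum {suc n} f = cong (f zero ℕ.+_) (sumℕ≡sum (f ∘ suc))

sumℕ-mono-≤ : ∀ {n} {f g : Fin n → ℕ} → (∀ i → f i ℕ.≤ g i) → sumℕ f ℕ.≤ sumℕ g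
sumℕ-mono-≤ {zero}  f≤g = ℕ.z≤n
sumℕ-mono-≤ {suc n} f≤g = ℕ.+-mono-≤ (f≤g zero) (sumℕ-mono-≤ (f≤g ∘ suc))

sum-mono-≤ : ∀ {n} {f g : Fin n → ℚ} → (∀ i → f i ≤ g i) → sum f ≤ sum g
sum-mono-≤ {zero}  f≤g = ℚ.≤-refl
sum-mono-≤ {suc n} f≤g = ℚ.+-mono-≤ (f≤g zero) (sum-mono-≤ (f≤g ∘ suc))

sum-mono-< : ∀ {n} {f g : Fin n → ℚ} → (∀ i → f i ≤ g i) → ∀ j → f j < g j → sum f < sum g
sum-mono-< f≤g zero    fj<gj = ℚ.+-mono-<-≤ fj<gj (sum-mono-≤ (f≤g ∘ suc))
sum-mono-< f≤g (suc j) fj<gj = ℚ.+-mono-≤-< (f≤g zero) (sum-mono-< (f≤g ∘ suc) j fj<gj)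

sum-if-≤⇒∃ : ∀ {n} (B : Fin n → Bool) {c j} (a : Fin n → ℚ) → B j ≡ true →
             sum (λ i → if B i then c else 0ℚ) ≤ sum (λ i → if B i then a i else 0ℚ) →
             ∃[ i ] c ≤ a i
sum-if-≤⇒∃ B {c} {j} a Bj ∑c≤∑a with any? (λ i → c ℚ.≤? a i)
... | yes found = found
... | no  none  = contradiction (ℚ.<-≤-trans (sum-mono-< below j strict) ∑c≤∑a) (ℚ.<-irrefl refl)
  where
  a<c : ∀ i → a i < c
  a<c i = ℚ.≰⇒> (none ∘ (i ,_))
  below : ∀ i → (if B i then a i else 0ℚ) ≤ (if B i then c else 0ℚ)
  below i with B i
  ... | true  = ℚ.<⇒≤ (a<c i)
  ... | false = ℚ.≤-refl
  strict : (if B j then a j else 0ℚ) < (if B j then c else 0ℚ)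
  strict rewrite Bj = a<c j

ℕ→ℚ≡mkℚ : ∀ k → ℕ→ℚ k ≡ mkℚ (+ k) 0 (Coprime.sym (Coprime.1-coprimeTo k))
ℕ→ℚ≡mkℚ k = ℚ.normalize-coprime (Coprime.sym (Coprime.1-coprimeTo k))

ℕ→ℚ-+ : ∀ a b → ℕ→ℚ (a ℕ.+ b) ≡ ℕ→ℚ a + ℕ→ℚ b
ℕ→ℚ-+ a b rewrite ℕ→ℚ≡mkℚ a | ℕ→ℚ≡mkℚ b =
  cong (_/ 1) (≡.sym (cong₂ ℤ._+_ (ℤ.*-identityʳ (+ a)) (ℤ.*-identityʳ (+ b))))

ℕ→ℚ-mono-≤ : ∀ {a b} → a ℕ.≤ b → ℕ→ℚ a ≤ ℕ→ℚ b
ℕ→ℚ-mono-≤ {a} {b} a≤b rewrite ℕ→ℚ≡mkℚ a | ℕ→ℚ≡mkℚ b =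
  *≤* (subst₂ ℤ._≤_ (≡.sym (ℤ.*-identityʳ (+ a))) (≡.sym (ℤ.*-identityʳ (+ b))) (ℤ.+≤+ a≤b))

ℕ→ℚ-sumℕ : ∀ {n} (f : Fin n → ℕ) → ℕ→ℚ (sumℕ f) ≡ sum (ℕ→ℚ ∘ f)
ℕ→ℚ-sumℕ {zero}  f = refl
ℕ→ℚ-sumℕ {suc n} f =
  ≡.trans (ℕ→ℚ-+ (f zero) _) (cong (λ s → ℕ→ℚ (f zero) + s) (ℕ→ℚ-sumℕ (f ∘ suc)))

[_]ℚ : Bool → ℚ
[ b ]ℚ = ℕ→ℚ [ b ]ℕ

1≤[a]+[b] : ∀ {a b} → a ≡ true ⊎ b ≡ true → 1ℚ ≤ [ a ]ℚ + [ b ]ℚ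
1≤[a]+[b] {a} {b} a∨b = subst (1ℚ ≤_) (ℕ→ℚ-+ [ a ]ℕ [ b ]ℕ) (ℕ→ℚ-mono-≤ (1≤ a∨b))
  where
  1≤ : a ≡ true ⊎ b ≡ true → 1 ℕ.≤ [ a ]ℕ ℕ.+ [ b ]ℕ
  1≤ (inj₁ refl) = ℕ.s≤s ℕ.z≤n
  1≤ (inj₂ refl) = ℕ.m≤n+m 1 [ a ]ℕ

count : ∀ {n} → (Fin n → Bool) → ℕ
count B = sumℕ (λ i → [ B i ]ℕ)

count-cong : ∀ {n} {B C : Fin n → Bool} → (∀ i → B i ≡ C i) → count B ≡ count C
count-cong {B = B} {C} B≗C = begin
  count B                 ≡⟨ sumℕ≡sum (λ i → [ B i ]ℕ) ⟩
  ∑ℕ.sum (λ i → [ B i ]ℕ) ≡⟨ ∑ℕ.sum-cong-≗ (cong [_]ℕ ∘ B≗C) ⟩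
  ∑ℕ.sum (λ i → [ C i ]ℕ) ≡⟨ sumℕ≡sum (λ i → [ C i ]ℕ) ⟨
  count C                 ∎
  where open ≡.≡-Reasoning

true⇒1≤count : ∀ {n} (B : Fin n → Bool) {i} → B i ≡ true → 1 ℕ.≤ count B
true⇒1≤count B {zero}  Bi rewrite Bi = ℕ.s≤s ℕ.z≤n
true⇒1≤count B {suc i} Bi = ℕ.≤-trans (true⇒1≤count (B ∘ suc) Bi) (ℕ.m≤n+m _ [ B zero ]ℕ)

1≤count⇒∃ : ∀ {n} (B : Fin n → Bool) → 1 ℕ.≤ count B → ∃[ i ] B i ≡ true
1≤count⇒∃ {suc n} B 1≤count with B zero in B0
... | true  = zero , B0
... | false = let i , Bi = 1≤count⇒∃ (B ∘ suc) 1≤count in suc i , Bi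

∣p∣≡count : ∀ {n} (p : Subset n) → ∣ p ∣ ≡ count (lookup p)
∣p∣≡count []          = refl
∣p∣≡count (true  ∷ p) = cong suc (∣p∣≡count p)
∣p∣≡count (false ∷ p) = ∣p∣≡count p

sum-if-const : ∀ {n} (B : Fin n → Bool) c → sum (λ i → if B i then c else 0ℚ) ≡ ℕ→ℚ (count B) * c
sum-if-const B c = begin
  sum (λ i → if B i then c else 0ℚ) ≡⟨ sum-cong-≗ (if≡[]* ∘ B) ⟩
  sum (λ i → [ B i ]ℚ * c)          ≡⟨ *-distribʳ-sum c (λ i → [ B i ]ℚ) ⟨
  sum (λ i → [ B i ]ℚ) * c          ≡⟨ cong (_* c) (ℕ→ℚ-sumℕ (λ i → [ B i ]ℕ)) ⟨
  ℕ→ℚ (count B) * c                 ∎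
  where
  open ≡.≡-Reasoning
  if≡[]* : ∀ b → (if b then c else 0ℚ) ≡ [ b ]ℚ * c
  if≡[]* true  = ≡.sym (ℚ.*-identityˡ c)
  if≡[]* false = ≡.sym (ℚ.*-zeroˡ c)

p≤q⇒0≤q-p : ∀ {p q} → p ≤ q → 0ℚ ≤ q - p
p≤q⇒0≤q-p {p} {q} p≤q = subst (_≤ q - p) (ℚ.+-inverseʳ p) (ℚ.+-monoˡ-≤ (- p) p≤q)

0≤p*q : ∀ {p q} → 0ℚ ≤ p → 0ℚ ≤ q → 0ℚ ≤ p * q
0≤p*q {p} {q} 0≤p 0≤q = subst (_≤ p * q) (ℚ.*-zeroʳ p) (ℚ.*-monoˡ-≤-nonNeg p {{nonNegative 0≤p}} 0≤q)

p≤p+q : ∀ p {q} → 0ℚ ≤ q → p ≤ p + q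
p≤p+q p {q} 0≤q = subst (_≤ p + q) (ℚ.+-identityʳ p) (ℚ.+-monoʳ-≤ p 0≤q)

+-cancelʳ-≤ : ∀ a b c → a + c ≤ b + c → a ≤ b
+-cancelʳ-≤ a b c a+c≤b+c = subst₂ _≤_ (cancel a) (cancel b) (ℚ.+-monoˡ-≤ (- c) a+c≤b+c)
  where
  cancel : ∀ x → x + c + - c ≡ x
  cancel x = solve 2 (λ x c → x :+ c :- c := x) refl x c

-- Distance two

∨-true : ∀ a {b} → a ∨ b ≡ true → a ≡ true ⊎ b ≡ true
∨-true true  _   = inj₁ refl
∨-true false b≡t = inj₂ b≡t

≟-true⇒≡ : ∀ {n} {x y : Fin n} → does (x ≟ y) ≡ true → x ≡ y
≟-true⇒≡ {x = x} {y} eq with x ≟ y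
... | yes x≡y = x≡y
... | no  _   = contradiction eq λ ()

not-≟-true⇒≢ : ∀ {n} {x y : Fin n} → not (does (x ≟ y)) ≡ true → x ≢ y
not-≟-true⇒≢ {x = x} {y} eq x≡y =
  contradiction (≡.trans (≡.sym eq) (cong not (dec-true (x ≟ y) x≡y))) λ ()

anyFin-intro : ∀ {n} (f : Fin n → Bool) i → f i ≡ true → anyFin f ≡ true
anyFin-intro f zero    fi rewrite fi = refl
anyFin-intro f (suc i) fi = ≡.trans (cong (f zero ∨_) (anyFin-intro (f ∘ suc) i fi)) (∨-zeroʳ (f zero))

anyFin-elim : ∀ {n} (f : Fin n → Bool) → anyFin f ≡ true → ∃[ i ] f i ≡ true
anyFin-elim {suc n} f any with ∨-true (f zero) any
... | inj₁ f0   = zero , f0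
... | inj₂ rest = let i , fi = anyFin-elim (f ∘ suc) rest in suc i , fi

ballA-step : ∀ {n} (R : Fin n → Fin n → Bool) {k u v w} →
             R u w ≡ true → ballA R k w v ≡ true → ballA R (suc k) u v ≡ true
ballA-step R {k} {u} {v} {w} Ruw wv =
  ≡.trans (cong (ballA R k u v ∨_) (anyFin-intro (λ t → R u t ∧ ballA R k t v) w (cong₂ _∧_ Ruw wv)))
          (∨-zeroʳ _)

ballA-1 : ∀ {n} (R : Fin n → Fin n → Bool) {u v} → ballA R 1 u v ≡ true → u ≡ v ⊎ R u v ≡ true
ballA-1 R {u} {v} h with ∨-true (does (u ≟ v)) h
... | inj₁ u≡v = inj₁ (≟-true⇒≡ u≡v)
... | inj₂ any with anyFin-elim (λ w → R u w ∧ does (w ≟ v)) any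
...   | w , Ruw∧w≡v =
  inj₂ (subst (λ t → R u t ≡ true) (≟-true⇒≡ (∧-conicalʳ _ _ Ruw∧w≡v)) (∧-conicalˡ _ _ Ruw∧w≡v))

-- ball G k is ballA (Adj G) k by definition, so the ballA lemmas apply to ball.
dist-2 : ∀ {n} (G : Graph n) {u v w} → u ≢ v → ¬ Edge G u v → Edge G u w → Edge G w v → Dist G u v 2
dist-2 G {u} {v} u≢v ¬uv uw wv = cong₂ (λ a b → a ∧ not b) within-2 not-within-1
  where
  within-2 : ball G 2 u v ≡ true
  within-2 = ballA-step (Adj G) {k = 1} uw (ballA-step (Adj G) {k = 0} wv (dec-true (v ≟ v) refl))
  not-within-1 : ball G 1 u v ≡ false
  not-within-1 = ¬-not λ h → [ u≢v , ¬uv ]′ (ballA-1 (Adj G) h)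

inNto-2⇒path : ∀ {n} (G : Graph n) {u v x} → inNto G 2 u v x ≡ true → Edge G u x × Edge G x v
inNto-2⇒path G {u} {v} {x} h =
  ∧-conicalˡ _ _ h , fromInj₂ (λ x≡v → contradiction x≡v x≢v) (ballA-1 (Adj G) within-1)
  where
  at-distance-1 : distIs G x v 1 ≡ true
  at-distance-1 = ∧-conicalʳ (Adj G u x) _ h
  within-1 : ball G 1 x v ≡ true
  within-1 = ∧-conicalˡ (ball G 1 x v) _ at-distance-1
  x≢v : x ≢ v
  x≢v = not-≟-true⇒≢ (∧-conicalʳ (ball G 1 x v) _ at-distance-1)

-- Girth at least five

Edge-sym : ∀ {n} (G : Graph n) {u v} → Edge G u v → Edge G v u
Edge-sym G {u} {v} = ≡.trans (sym G v u)

Edge⇒≢ : ∀ {n} (G : Graph n) {u v} → Edge G u v → u ≢ v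
Edge⇒≢ G {u} uv refl = contradiction (≡.trans (≡.sym (irrefl G u)) uv) λ ()

cycle : ∀ {n} (G : Graph n) {m} (vs : Vec (Fin n) (suc m)) → Unique vs →
        (∀ i → Edge G (lookup vs (inject₁ i)) (lookup vs (suc i))) →
        Edge G (lookup vs (fromℕ m)) (lookup vs zero) → Cycle G (suc m)
cycle G vs distinct path closing = lookup vs , lookup-injective distinct _ _ , path , closing

module _ {n} {G : Graph n} (girth : GirthAtLeast G 5) where

  triangle-free : ∀ {u v w} → Edge G u w → Edge G w v → ¬ Edge G v u
  triangle-free {u} {v} {w} uw wv vu =
    girth 3 ℕ.≤-refl (ℕ.n≤1+n 4) (cycle G (u ∷ w ∷ v ∷ []) distinct path vu)
    where
    distinct : Unique (u ∷ w ∷ v ∷ [])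
    distinct = (Edge⇒≢ G uw ∷ ≢-sym (Edge⇒≢ G vu) ∷ []) ∷ (Edge⇒≢ G wv ∷ []) ∷ [] ∷ []
    path : ∀ i → Edge G (lookup (u ∷ w ∷ v ∷ []) (inject₁ i)) (lookup (u ∷ w ∷ v ∷ []) (suc i))
    path zero       = uw
    path (suc zero) = wv

  unique-common-neighbour : ∀ {u v w x} → u ≢ v → Edge G u w → Edge G w v →
                            Edge G u x → Edge G x v → x ≡ w
  unique-common-neighbour {u} {v} {w} {x} u≢v uw wv ux xv = decidable-stable (x ≟ w) λ x≢w →
    girth 4 (ℕ.n≤1+n 3) ℕ.≤-refl (cycle G (u ∷ x ∷ v ∷ w ∷ []) (distinct x≢w) path (Edge-sym G uw))
    where
    distinct : x ≢ w → Unique (u ∷ x ∷ v ∷ w ∷ [])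
    distinct x≢w = (Edge⇒≢ G ux ∷ u≢v ∷ Edge⇒≢ G uw ∷ []) ∷ (Edge⇒≢ G xv ∷ x≢w ∷ [])
                 ∷ (≢-sym (Edge⇒≢ G wv) ∷ []) ∷ [] ∷ []
    path : ∀ i → Edge G (lookup (u ∷ x ∷ v ∷ w ∷ []) (inject₁ i)) (lookup (u ∷ x ∷ v ∷ w ∷ []) (suc i))
    path zero             = ux
    path (suc zero)       = xv
    path (suc (suc zero)) = Edge-sym G wv

  cherry⇒dist-2 : ∀ {u v w} → u ≢ v → Edge G u w → Edge G w v → Dist G u v 2
  cherry⇒dist-2 u≢v uw wv = dist-2 G u≢v (triangle-free uw wv ∘ Edge-sym G) uw wv

-- Guidance systems cover cherries

CoversCherries : ∀ {n} → Graph n → (Fin n → Fin n → ℚ) → Set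
CoversCherries G p = ∀ {u v w} → u ≢ v → Edge G u w → Edge G v w → 1ℚ ≤ p u w + p v w

module _ {n} {G : Graph n} (girth : GirthAtLeast G 5) where

  sum-toward≤ : ∀ {p} → FractionalOrientation G p → ∀ {u v w} → u ≢ v → Edge G u w → Edge G w v →
                sumℚ (λ x → if inNto G 2 u v x then p u x else 0ℚ) ≤ p u w
  sum-toward≤ {p} p≥0 {u} {v} {w} u≢v uw wv = begin
    sumℚ (λ x → if inNto G 2 u v x then p u x else 0ℚ) ≡⟨ sumℚ≡sum (λ x → if inNto G 2 u v x then p u x else 0ℚ) ⟩
    sum (λ x → if inNto G 2 u v x then p u x else 0ℚ)  ≤⟨ sum-mono-≤ only-w ⟩
    sum (λ x → if does (x ≟ w) then p u x else 0ℚ)     ≡⟨ sum-select ℚ.+-0-commutativeMonoid (p u) w ⟩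
    p u w                                              ∎
    where
    open ℚ.≤-Reasoning
    only-w : ∀ x → (if inNto G 2 u v x then p u x else 0ℚ) ≤ (if does (x ≟ w) then p u x else 0ℚ)
    only-w x with inNto G 2 u v x in toward | x ≟ w
    ... | true  | yes _    = ℚ.≤-refl
    ... | true  | no x≢w   =
      contradiction (uncurry (unique-common-neighbour girth u≢v uw wv) (inNto-2⇒path G toward)) x≢w
    ... | false | yes refl = p≥0 u w uw
    ... | false | no _     = ℚ.≤-refl

  fractional⇒covers : ∀ {p} → FractionalOrientation G p → FractionalGuidance G 2 p → CoversCherries G p
  fractional⇒covers p≥0 guide {u} {v} {w} u≢v uw vw =
    ℚ.≤-trans (guide u v 2 ℕ.≤-refl ℕ.≤-refl (cherry⇒dist-2 girth u≢v uw (Edge-sym G vw)))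
              (ℚ.+-mono-≤ (sum-toward≤ p≥0 u≢v uw (Edge-sym G vw))
                          (sum-toward≤ p≥0 (≢-sym u≢v) vw (Edge-sym G uw)))

asFractional : ∀ {n} → (Fin n → Fin n → Bool) → Fin n → Fin n → ℚ
asFractional A u v = [ A u v ]ℚ

asFractional-nonNeg : ∀ {n} (G : Graph n) A → FractionalOrientation G (asFractional A)
asFractional-nonNeg G A u v _ = ℕ→ℚ-mono-≤ {b = [ A u v ]ℕ} ℕ.z≤n

fracOutdeg-asFractional : ∀ {n} {G : Graph n} {A} → PartialOrientation G A →
                          ∀ u → fracOutdeg G (asFractional A) u ≡ ℕ→ℚ (outdegA A u)
fracOutdeg-asFractional {G = G} {A} orient u = begin
  fracOutdeg G (asFractional A) u                  ≡⟨ sumℚ≡sum (λ v → if Adj G u v then [ A u v ]ℚ else 0ℚ) ⟩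
  sum (λ v → if Adj G u v then [ A u v ]ℚ else 0ℚ) ≡⟨ sum-cong-≗ arcs-are-edges ⟩
  sum (λ v → [ A u v ]ℚ)                           ≡⟨ ℕ→ℚ-sumℕ (λ v → [ A u v ]ℕ) ⟨
  ℕ→ℚ (outdegA A u)                                ∎
  where
  open ≡.≡-Reasoning
  arcs-are-edges : ∀ v → (if Adj G u v then [ A u v ]ℚ else 0ℚ) ≡ [ A u v ]ℚ
  arcs-are-edges v with A u v in arc
  ... | true rewrite orient u v arc = refl
  ... | false with Adj G u v
  ...   | true  = refl
  ...   | false = refl

module _ {n} {G : Graph n} (girth : GirthAtLeast G 5) {A} (orient : PartialOrientation G A) where

  weak-witness⇒arc : ∀ {u v w x y} → u ≢ v → Edge G u w → Edge G w v →
                     ballA A 0 u x ≡ true → ballA A 1 v y ≡ true → Edge G x y → A v w ≡ true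
  weak-witness⇒arc {u} {v} {w} {x} {y} u≢v uw wv ux vy xy with ≟-true⇒≡ {x = u} {x} ux | ballA-1 A {v} {y} vy
  ... | refl | inj₁ refl = contradiction (Edge-sym G xy) (triangle-free girth uw wv)
  ... | refl | inj₂ arc  =
    subst (λ t → A v t ≡ true) (unique-common-neighbour girth u≢v uw wv xy (Edge-sym G (orient v y arc))) arc

  weak⇒covers : WeakGuidance G 2 A → CoversCherries G (asFractional A)
  weak⇒covers guide {u} {v} {w} u≢v uw vw
    with guide u v 2 u≢v ℕ.≤-refl (cherry⇒dist-2 girth u≢v uw (Edge-sym G vw))
  ... | 0 , _ , refl , x , y , ux , vy , xy =
    1≤[a]+[b] {A u w} {A v w} (inj₂ (weak-witness⇒arc u≢v uw (Edge-sym G vw) ux vy xy))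
  ... | 1 , _ , refl , x , y , ux , vy , xy =
    1≤[a]+[b] {A u w} {A v w} (inj₁ (weak-witness⇒arc (≢-sym u≢v) vw (Edge-sym G uw) vy ux (Edge-sym G xy)))

-- Double counting

module _ {n} (B : Fin n → Bool) (x : Fin n → ℚ)
         (covered : ∀ {u v} → u ≢ v → B u ≡ true → B v ≡ true → 1ℚ ≤ x u + x v) where

  -- Every other weight is at least 1 - x u₀, which exceeds 1/2 when x u₀ < 1/2.
  light-vertex-bound : ∀ {u₀} → B u₀ ≡ true →
                       ℕ→ℚ (count B) * (1ℚ - x u₀) + (x u₀ - (1ℚ - x u₀))
                         ≤ sum (λ u → if B u then x u else 0ℚ)
  light-vertex-bound {u₀} Bu₀ = begin
    K * (1ℚ - y) + (y - (1ℚ - y))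
      ≡⟨ cong₂ _+_ (sum-if-const B (1ℚ - y)) (sum-select ℚ.+-0-commutativeMonoid (λ _ → y - (1ℚ - y)) u₀) ⟨
    sum rest + sum at-u₀
      ≡⟨ ∑-distrib-+ rest at-u₀ ⟨
    sum (λ u → rest u + at-u₀ u)
      ≤⟨ sum-mono-≤ lower-bound ⟩
    sum (λ u → if B u then x u else 0ℚ) ∎
    where
    open ℚ.≤-Reasoning
    K = ℕ→ℚ (count B)
    y = x u₀
    rest at-u₀ : Fin n → ℚ
    rest u = if B u then 1ℚ - y else 0ℚ
    at-u₀ u = if does (u ≟ u₀) then y - (1ℚ - y) else 0ℚ
    lower-bound : ∀ u → rest u + at-u₀ u ≤ (if B u then x u else 0ℚ)
    lower-bound u with u ≟ u₀
    ... | yes refl rewrite Bu₀ =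
      ℚ.≤-reflexive (solve 1 (λ y → (con 1ℚ :- y) :+ (y :- (con 1ℚ :- y)) := y) refl y)
    ... | no u≢u₀ with B u in Bu
    ...   | true  = subst (_≤ x u) (≡.sym (ℚ.+-identityʳ (1ℚ - y)))
                      (subst (1ℚ - y ≤_) (solve 2 (λ y z → (y :+ z) :- y := z) refl y (x u))
                        (ℚ.+-monoˡ-≤ (- y) (covered (≢-sym u≢u₀) Bu₀ Bu)))
    ...   | false = ℚ.≤-refl

  half-count≤sum : count B ≢ 1 → ℕ→ℚ (count B) * ½ ≤ sum (λ u → if B u then x u else 0ℚ)
  half-count≤sum count≢1 with any? (λ u → (B u Bool.≟ true) ×-dec (x u ℚ.<? ½))
  ... | no none = begin
    ℕ→ℚ (count B) * ½                   ≡⟨ sum-if-const B ½ ⟨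
    sum (λ u → if B u then ½ else 0ℚ)   ≤⟨ sum-mono-≤ half≤x ⟩
    sum (λ u → if B u then x u else 0ℚ) ∎
    where
    open ℚ.≤-Reasoning
    half≤x : ∀ u → (if B u then ½ else 0ℚ) ≤ (if B u then x u else 0ℚ)
    half≤x u with B u in Bu
    ... | true  = ℚ.≮⇒≥ (λ x<½ → none (u , Bu , x<½))
    ... | false = ℚ.≤-refl
  ... | yes (u₀ , Bu₀ , y<½) = ℚ.≤-trans K/2≤ (light-vertex-bound Bu₀)
    where
    K = ℕ→ℚ (count B)
    y = x u₀
    2≤count : 2 ℕ.≤ count B
    2≤count = ℕ.≤∧≢⇒< (true⇒1≤count B Bu₀) (≢-sym count≢1)
    K/2≤ : K * ½ ≤ K * (1ℚ - y) + (y - (1ℚ - y))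
    K/2≤ = subst (K * ½ ≤_)
      (solve 2 (λ K y → K :* con ½ :+ (K :- con (ℕ→ℚ 2)) :* (con ½ :- y)
                        := K :* (con 1ℚ :- y) :+ (y :- (con 1ℚ :- y))) refl K y)
      (p≤p+q (K * ½) (0≤p*q (p≤q⇒0≤q-p (ℕ→ℚ-mono-≤ 2≤count)) (p≤q⇒0≤q-p (ℚ.<⇒≤ y<½))))

deg : ∀ {n} {G : Graph n} → Subgraph G → Fin n → ℕ
deg H x = count (F H x)

Leafless : ∀ {n} {G : Graph n} → Subgraph G → Set
Leafless H = ∀ x → deg H x ≢ 1

module _ {n} {G : Graph n} {p : Fin n → Fin n → ℚ} (p≥0 : FractionalOrientation G p) where

  in-weight : CoversCherries G p → (H : Subgraph G) → Leafless H →
              ∀ w → ℕ→ℚ (deg H w) * ½ ≤ sum (λ u → if F H u w then p u w else 0ℚ)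
  in-weight covers H leafless w =
    subst (λ k → ℕ→ℚ k * ½ ≤ sum (λ u → if F H u w then p u w else 0ℚ)) in-degree
      (half-count≤sum (λ u → F H u w) (λ u → p u w)
         (λ u≢v uw vw → covers u≢v (F-edge H _ w uw) (F-edge H _ w vw))
         (leafless w ∘ ≡.trans (≡.sym in-degree)))
    where
    in-degree : count (λ u → F H u w) ≡ deg H w
    in-degree = count-cong (λ u → F-sym H u w)

  out-weight : (H : Subgraph G) → ∀ u →
               sum (λ w → if F H u w then p u w else 0ℚ) ≤ (if lookup (S H) u then fracOutdeg G p u else 0ℚ)
  out-weight H u with lookup (S H) u in u∈S
  ... | true = begin
    sum (λ w → if F H u w then p u w else 0ℚ)   ≤⟨ sum-mono-≤ H-edges-are-edges ⟩
    sum (λ w → if Adj G u w then p u w else 0ℚ) ≡⟨ sumℚ≡sum (λ w → if Adj G u w then p u w else 0ℚ) ⟨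
    fracOutdeg G p u                            ∎
    where
    open ℚ.≤-Reasoning
    H-edges-are-edges : ∀ w → (if F H u w then p u w else 0ℚ) ≤ (if Adj G u w then p u w else 0ℚ)
    H-edges-are-edges w with F H u w in uw
    ... | true rewrite F-edge H u w uw = ℚ.≤-refl
    ... | false with Adj G u w in edge
    ...   | true  = p≥0 u w edge
    ...   | false = ℚ.≤-refl
  ... | false = ℚ.≤-trans (sum-mono-≤ no-edges) (ℚ.≤-reflexive (sum-replicate-zero n))
    where
    no-edges : ∀ w → (if F H u w then p u w else 0ℚ) ≤ 0ℚ
    no-edges w with F H u w in uw
    ... | true  = contradiction (≡.trans (≡.sym u∈S) (Vec.[]=⇒lookup (proj₁ (F-inS H u w uw)))) λ ()
    ... | false = ℚ.≤-refl

  covers⇒maxOutdeg≥ : CoversCherries G p → ∀ {d} (H : Subgraph G) →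
                      1 ℕ.≤ ∣ S H ∣ → AvgDeg≡ H d → Leafless H → FracMaxOutdeg≥ G p (d * ½)
  covers⇒maxOutdeg≥ covers {d} H nonempty avg leafless =
    sum-if-≤⇒∃ inS (fracOutdeg G p) (proj₂ member) (begin
      sum (λ u → if inS u then d * ½ else 0ℚ)               ≡⟨ sum-if-const inS (d * ½) ⟩
      ℕ→ℚ (count inS) * (d * ½)                             ≡⟨ cong (λ s → ℕ→ℚ s * (d * ½)) (∣p∣≡count (S H)) ⟨
      ℕ→ℚ ∣ S H ∣ * (d * ½)                                 ≡⟨ solve 2 (λ s d → s :* (d :* con ½) := d :* s :* con ½) refl (ℕ→ℚ ∣ S H ∣) d ⟩
      d * ℕ→ℚ ∣ S H ∣ * ½                                   ≡⟨ cong (_* ½) avg ⟨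
      ℕ→ℚ (twiceEdges H) * ½                                ≡⟨ cong (_* ½) (ℕ→ℚ-sumℕ (deg H)) ⟩
      sum (λ w → ℕ→ℚ (deg H w)) * ½                         ≡⟨ *-distribʳ-sum ½ (λ w → ℕ→ℚ (deg H w)) ⟩
      sum (λ w → ℕ→ℚ (deg H w) * ½)                         ≤⟨ sum-mono-≤ (in-weight covers H leafless) ⟩
      sum (λ w → sum (λ u → if F H u w then p u w else 0ℚ)) ≡⟨ ∑-comm (λ u w → if F H u w then p u w else 0ℚ) ⟨
      sum (λ u → sum (λ w → if F H u w then p u w else 0ℚ)) ≤⟨ sum-mono-≤ (out-weight H) ⟩
      sum (λ u → if inS u then fracOutdeg G p u else 0ℚ)    ∎)
    where
    open ℚ.≤-Reasoning
    inS : Fin n → Bool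
    inS = lookup (S H)
    member : ∃[ u ] inS u ≡ true
    member = 1≤count⇒∃ inS (subst (1 ℕ.≤_) (∣p∣≡count (S H)) nonempty)

-- Deleting vertices of degree one

deleteVertex : ∀ {n} {G : Graph n} → Subgraph G → Fin n → Subgraph G
deleteVertex {n} H x = record
  { S      = S H ∖ x
  ; F      = F′
  ; F-sym  = λ u v → cong₂ _∧_ (F-sym H u v) (∧-comm (avoids u) (avoids v))
  ; F-edge = λ u v uv → F-edge H u v (∧-conicalˡ _ _ uv)
  ; F-inS  = inS
  }
  where
  avoids : Fin n → Bool
  avoids u = not (does (u ≟ x))
  F′ : Fin n → Fin n → Bool
  F′ u v = F H u v ∧ (avoids u ∧ avoids v)
  inS : ∀ u v → F′ u v ≡ true → (u ∈ S H ∖ x) × (v ∈ S H ∖ x)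
  inS u v uv = x∈p∧x≢y⇒x∈p-y (proj₁ (F-inS H u v H-edge)) (not-≟-true⇒≢ (∧-conicalˡ _ _ avoided))
             , x∈p∧x≢y⇒x∈p-y (proj₂ (F-inS H u v H-edge)) (not-≟-true⇒≢ (∧-conicalʳ (avoids u) _ avoided))
    where
    H-edge = ∧-conicalˡ _ _ uv
    avoided = ∧-conicalʳ (F H u v) _ uv

split-edge : ∀ c a b →
             [ c ]ℕ ℕ.≤ [ c ∧ (not a ∧ not b) ]ℕ ℕ.+ (if a then [ c ]ℕ else 0) ℕ.+ (if b then [ c ]ℕ else 0)
split-edge false _     _     = ℕ.z≤n
split-edge true  true  _     = ℕ.s≤s ℕ.z≤n
split-edge true  false true  = ℕ.s≤s ℕ.z≤n
split-edge true  false false = ℕ.s≤s ℕ.z≤n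

twiceEdges-deleteVertex : ∀ {n} {G : Graph n} (H : Subgraph G) x →
                          twiceEdges H ℕ.≤ twiceEdges (deleteVertex H x) ℕ.+ deg H x ℕ.+ deg H x
twiceEdges-deleteVertex {n} H x = begin
  twiceEdges H
    ≤⟨ sumℕ-mono-≤ (λ u → sumℕ-mono-≤ (λ v → split-edge (F H u v) (does (u ≟ x)) (does (v ≟ x)))) ⟩
  sumℕ (λ u → sumℕ (λ v → [ F′ u v ]ℕ ℕ.+ from-x u v ℕ.+ to-x u v))
    ≡⟨ sumℕ₂≡∑₂ (λ u v → [ F′ u v ]ℕ ℕ.+ from-x u v ℕ.+ to-x u v) ⟩
  ∑₂ (λ u v → [ F′ u v ]ℕ ℕ.+ from-x u v ℕ.+ to-x u v)
    ≡⟨ ≡.trans (∑₂-distrib-+ (λ u v → [ F′ u v ]ℕ ℕ.+ from-x u v) to-x)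
               (cong (ℕ._+ ∑₂ to-x) (∑₂-distrib-+ (λ u v → [ F′ u v ]ℕ) from-x)) ⟩
  ∑₂ (λ u v → [ F′ u v ]ℕ) ℕ.+ ∑₂ from-x ℕ.+ ∑₂ to-x
    ≡⟨ cong₂ ℕ._+_ (cong₂ ℕ._+_ (≡.sym (sumℕ₂≡∑₂ (λ u v → [ F′ u v ]ℕ))) ∑from-x) ∑to-x ⟩
  twiceEdges (deleteVertex H x) ℕ.+ deg H x ℕ.+ deg H x
    ∎
  where
  open ℕ.≤-Reasoning
  F′ = F (deleteVertex H x)
  ∑₂ : (Fin n → Fin n → ℕ) → ℕ
  ∑₂ f = ∑ℕ.sum (λ u → ∑ℕ.sum (f u))
  sumℕ₂≡∑₂ : ∀ f → sumℕ (λ u → sumℕ (f u)) ≡ ∑₂ f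
  sumℕ₂≡∑₂ f = ≡.trans (sumℕ≡sum (λ u → sumℕ (f u))) (∑ℕ.sum-cong-≗ (sumℕ≡sum ∘ f))
  ∑₂-distrib-+ : ∀ f g → ∑₂ (λ u v → f u v ℕ.+ g u v) ≡ ∑₂ f ℕ.+ ∑₂ g
  ∑₂-distrib-+ f g = ≡.trans (∑ℕ.sum-cong-≗ (λ u → ∑ℕ.∑-distrib-+ (f u) (g u)))
                             (∑ℕ.∑-distrib-+ (λ u → ∑ℕ.sum (f u)) (λ u → ∑ℕ.sum (g u)))
  from-x to-x : Fin n → Fin n → ℕ
  from-x u v = if does (u ≟ x) then [ F H u v ]ℕ else 0
  to-x   u v = if does (v ≟ x) then [ F H u v ]ℕ else 0
  deg≡∑ : deg H x ≡ ∑ℕ.sum (λ v → [ F H x v ]ℕ)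
  deg≡∑ = sumℕ≡sum (λ v → [ F H x v ]ℕ)
  ∑from-x : ∑₂ from-x ≡ deg H x
  ∑from-x = ≡.trans (∑ℕ.∑-comm from-x)
    (≡.trans (∑ℕ.sum-cong-≗ (λ v → sum-select ℕ.+-0-commutativeMonoid (λ u → [ F H u v ]ℕ) x)) (≡.sym deg≡∑))
  ∑to-x : ∑₂ to-x ≡ deg H x
  ∑to-x = ≡.trans (∑ℕ.sum-cong-≗ (λ u → ≡.trans (sum-select ℕ.+-0-commutativeMonoid (λ v → [ F H u v ]ℕ) x)
                                                (cong [_]ℕ (F-sym H u x))))
                  (≡.sym deg≡∑)

density-after-leaf-deletion : ∀ {d} {s s′ t t′ : ℕ} → ℕ→ℚ 2 ≤ d → s′ ℕ.< s →
                              ℕ→ℚ t ≡ d * ℕ→ℚ s → t ℕ.≤ t′ ℕ.+ 2 → d * ℕ→ℚ s′ ≤ ℕ→ℚ t′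
density-after-leaf-deletion {d} {s} {s′} {t} {t′} 2≤d s′<s avg t≤t′+2 = +-cancelʳ-≤ _ _ (ℕ→ℚ 2) (begin
  d * ℕ→ℚ s′ + ℕ→ℚ 2   ≤⟨ ℚ.+-monoʳ-≤ (d * ℕ→ℚ s′) 2≤d ⟩
  d * ℕ→ℚ s′ + d       ≡⟨ solve 2 (λ d s′ → d :* s′ :+ d := d :* (con 1ℚ :+ s′)) refl d (ℕ→ℚ s′) ⟩
  d * (1ℚ + ℕ→ℚ s′)    ≡⟨ cong (d *_) (ℕ→ℚ-+ 1 s′) ⟨
  d * ℕ→ℚ (suc s′)     ≤⟨ ℚ.*-monoˡ-≤-nonNeg d {{nonNegative 0≤d}} (ℕ→ℚ-mono-≤ s′<s) ⟩
  d * ℕ→ℚ s            ≡⟨ avg ⟨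
  ℕ→ℚ t                ≤⟨ ℕ→ℚ-mono-≤ t≤t′+2 ⟩
  ℕ→ℚ (t′ ℕ.+ 2)       ≡⟨ ℕ→ℚ-+ t′ 2 ⟩
  ℕ→ℚ t′ + ℕ→ℚ 2       ∎)
  where
  open ℚ.≤-Reasoning
  0≤d : 0ℚ ≤ d
  0≤d = ℚ.≤-trans (ℕ→ℚ-mono-≤ {b = 2} ℕ.z≤n) 2≤d

module _ {n} {G : Graph n} {d} (mad : IsMad G d) (2≤d : ℕ→ℚ 2 ≤ d) where

  deleteLeaf : (H : Subgraph G) → AvgDeg≡ H d → ∀ {x} → deg H x ≡ 1 →
               ∣ S (deleteVertex H x) ∣ ℕ.< ∣ S H ∣ × 1 ℕ.≤ ∣ S (deleteVertex H x) ∣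
               × AvgDeg≡ (deleteVertex H x) d
  deleteLeaf H avg {x} leaf = smaller , nonempty ,
    ℚ.≤-antisym (proj₁ mad H′ nonempty) (density-after-leaf-deletion 2≤d smaller avg fewer-edges)
    where
    H′ = deleteVertex H x
    neighbour : ∃[ y ] F H x y ≡ true
    neighbour = 1≤count⇒∃ (F H x) (ℕ.≤-reflexive (≡.sym leaf))
    y = proj₁ neighbour
    xy = proj₂ neighbour
    smaller : ∣ S H′ ∣ ℕ.< ∣ S H ∣
    smaller = x∈p⇒∣p-x∣<∣p∣ (proj₁ (F-inS H x y xy))
    y∈S′ : y ∈ S H′
    y∈S′ = x∈p∧x≢y⇒x∈p-y (proj₂ (F-inS H x y xy)) (≢-sym (Edge⇒≢ G (F-edge H x y xy)))
    nonempty : 1 ℕ.≤ ∣ S H′ ∣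
    nonempty = subst (1 ℕ.≤_) (≡.sym (∣p∣≡count (S H′))) (true⇒1≤count (lookup (S H′)) (Vec.[]=⇒lookup y∈S′))
    fewer-edges : twiceEdges H ℕ.≤ twiceEdges H′ ℕ.+ 2
    fewer-edges = subst (twiceEdges H ℕ.≤_)
                    (≡.trans (cong (λ k → twiceEdges H′ ℕ.+ k ℕ.+ k) leaf) (ℕ.+-assoc _ 1 1))
                    (twiceEdges-deleteVertex H x)

  leaflessDensest : Σ (Subgraph G) λ H → 1 ℕ.≤ ∣ S H ∣ × AvgDeg≡ H d × Leafless H
  leaflessDensest = let H , nonempty , avg = proj₂ mad in prune H (<-wellFounded _) nonempty avg
    where
    prune : ∀ H → Acc ℕ._<_ ∣ S H ∣ → 1 ℕ.≤ ∣ S H ∣ → AvgDeg≡ H d →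
            Σ (Subgraph G) λ H → 1 ℕ.≤ ∣ S H ∣ × AvgDeg≡ H d × Leafless H
    prune H (acc smaller) nonempty avg with any? (λ x → deg H x ℕ.≟ 1)
    ... | no  leafless   = H , nonempty , avg , λ x leaf → leafless (x , leaf)
    ... | yes (x , leaf) = let shrinks , nonempty′ , avg′ = deleteLeaf H avg leaf
                           in prune (deleteVertex H x) (smaller shrinks) nonempty′ avg′

lemma29 : ∀ {n} (G : Graph n) (d : ℚ) → GirthAtLeast G 5 → IsMad G d → (+ 2) / 1 ≤ d →
    (∀ (p : Fin n → Fin n → ℚ) → FractionalOrientation G p → FractionalGuidance G 2 p → FracMaxOutdeg≥ G p (d * ½))
    × (∀ (A : Fin n → Fin n → Bool) → PartialOrientation G A → WeakGuidance G 2 A → MaxOutdeg≥ A (d * ½))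
lemma29 G d girth mad 2≤d with leaflessDensest mad 2≤d
... | H , nonempty , avg , leafless = fractional , weak
  where
  maxOutdeg≥ : ∀ {p} → FractionalOrientation G p → CoversCherries G p → FracMaxOutdeg≥ G p (d * ½)
  maxOutdeg≥ p≥0 covers = covers⇒maxOutdeg≥ p≥0 covers {d} H nonempty avg leafless

  fractional : ∀ p → FractionalOrientation G p → FractionalGuidance G 2 p → FracMaxOutdeg≥ G p (d * ½)
  fractional p p≥0 guide = maxOutdeg≥ p≥0 (fractional⇒covers girth p≥0 guide)

  weak : ∀ A → PartialOrientation G A → WeakGuidance G 2 A → MaxOutdeg≥ A (d * ½)
  weak A orient guide =
    let u , d/2≤outdeg = maxOutdeg≥ (asFractional-nonNeg G A) (weak⇒covers girth orient guide)
    in u , subst (d * ½ ≤_) (fracOutdeg-asFractional {G = G} orient u) d/2≤outdeg
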